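{- Let $k\ge 3$. For every $n\ge 1$, the letter $n$ is the largest letter occurring in $W^{(k)}_n$, it occurs exactly once in $W^{(k)}_n$, and this occurrence is the last letter of $W^{(k)}_n$.
   Context: The alphabet is $\mathbb{N}=\{0,1,2,\dots\}$. For an integer $k\ge 3$, $\varphi_k$ is the morphism of $\mathbb{N}^*$ defined on letters, for $i\ge 0$ and $0\le j\le k-1$, by $\varphi_k(ki+j)=(ki)(ki+j+1)$ (two letters) if $0\le j\le k-2$, and $\varphi_k(ki+k-1)=(ki+k)$ (one letter). For $n\ge 0$, $W^{(k)}_n=\varphi_k^n(0)$. -}

module Defs where

open import Data.Nat using (ℕ; zero; suc; _+_; _*_; _∸_; NonZero; _≟_)
open import Data.Nat.DivMod using (_/_; _%_)
open import Data.List using (List; []; _∷_; concatMap; filter; length)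
open import Relation.Nullary using (Dec; yes; no)

-- φ_k on a single letter m = k·i + j, with i = m / k and j = m % k:
--   φ_k(ki+j)     = (ki)(ki+j+1)   if j ≤ k-2
--   φ_k(ki+k-1)   = (ki+k)
phiLetter : (k : ℕ) → .{{_ : NonZero k}} → ℕ → List ℕ
phiLetter k m with suc (m % k) ≟ k
... | yes _ = (k * (m / k) + k) ∷ []
... | no _  = (k * (m / k)) ∷ (k * (m / k) + (m % k) + 1) ∷ []

phi : (k : ℕ) → .{{_ : NonZero k}} → List ℕ → List ℕ
phi k w = concatMap (phiLetter k) w

W : (k : ℕ) → .{{_ : NonZero k}} → ℕ → List ℕ
W k zero    = 0 ∷ []
W k (suc n) = phi k (W k n)

occurrences : ℕ → List ℕ → ℕ
occurrences a w = length (filter (λ x → x ≟ a) w)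

-- Each letter m is sent by φ_k to a word ending in m + 1 whose other letters
-- are at most m. Hence if a word is u·n with every letter of u below n, its image
-- is u'·(n + 1) with every letter of u' below n + 1; starting from W_0 = 0 this
-- invariant gives all three claims for W_n.
module Submission where

open import Defs
open import Data.Nat using (ℕ; zero; suc; _+_; _*_; _≤_; _<_; NonZero; _≟_; s≤s)
open import Data.Nat.Properties using (≤-refl; ≤-trans; <⇒≤; <⇒≢; m≤m+n; +-comm; +-suc; *-comm)
open import Data.Nat.DivMod using (_/_; _%_; m≡m%n+[m/n]*n)
open import Data.List using (List; []; _∷_; _++_; _∷ʳ_; concatMap; filter; length; last)
open import Data.List.Properties using (++-assoc; ++-identityʳ; concatMap-++; filter-++; filter-none; filter-accept; length-++)
open import Data.List.Relation.Unary.All using (All; []; _∷_) renaming (map to All-map)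
open import Data.List.Relation.Unary.All.Properties using (++⁺; ∷ʳ⁺; concat⁺; map⁺)
open import Data.Maybe using (just)
open import Relation.Nullary using (yes; no)
open import Data.Product using (_×_; _,_; ∃-syntax)
open import Relation.Binary.PropositionalEquality using (_≡_; refl; sym; trans; cong; cong₂; subst; module ≡-Reasoning)

UniqueMaxLast : ℕ → List ℕ → Set
UniqueMaxLast n w = ∃[ u ] All (_< n) u × w ≡ u ∷ʳ n

last-∷ʳ : ∀ {A : Set} (xs : List A) x → last (xs ∷ʳ x) ≡ just x
last-∷ʳ []           x = refl
last-∷ʳ (_ ∷ [])     x = refl
last-∷ʳ (_ ∷ y ∷ ys) x = last-∷ʳ (y ∷ ys) x

module _ {n : ℕ} {w : List ℕ} where

  UniqueMaxLast⇒All≤ : UniqueMaxLast n w → All (_≤ n) w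
  UniqueMaxLast⇒All≤ (u , u<n , refl) = ∷ʳ⁺ (All-map <⇒≤ u<n) ≤-refl

  UniqueMaxLast⇒occurrences≡1 : UniqueMaxLast n w → occurrences n w ≡ 1
  UniqueMaxLast⇒occurrences≡1 (u , u<n , refl) = begin
    length (filter (_≟ n) (u ∷ʳ n))                     ≡⟨ cong length (filter-++ (_≟ n) u (n ∷ [])) ⟩
    length (filter (_≟ n) u ++ filter (_≟ n) (n ∷ []))  ≡⟨ length-++ (filter (_≟ n) u) ⟩
    length (filter (_≟ n) u) + length (filter (_≟ n) (n ∷ []))
      ≡⟨ cong₂ _+_ (cong length (filter-none (_≟ n) (All-map <⇒≢ u<n)))
                   (cong length (filter-accept (_≟ n) refl)) ⟩
    1                                                   ∎
    where open ≡-Reasoning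

  UniqueMaxLast⇒last : UniqueMaxLast n w → last w ≡ just n
  UniqueMaxLast⇒last (u , _ , refl) = last-∷ʳ u n

module LetterIncrementing
  (f : ℕ → List ℕ)
  (f-shape : ∀ m → ∃[ p ] All (_≤ m) p × f m ≡ p ∷ʳ suc m)
  where

  letter-bound : ∀ {m n} → m < n → All (_< suc n) (f m)
  letter-bound {m} m<n with f-shape m
  ... | p , p≤m , eq rewrite eq =
    ∷ʳ⁺ (All-map (λ x≤m → s≤s (≤-trans x≤m (<⇒≤ m<n))) p≤m) (s≤s m<n)

  concatMap-bound : ∀ {n u} → All (_< n) u → All (_< suc n) (concatMap f u)
  concatMap-bound u<n = concat⁺ (map⁺ (All-map letter-bound u<n))

  concatMap-UniqueMaxLast : ∀ {n w} → UniqueMaxLast n w → UniqueMaxLast (suc n) (concatMap f w)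
  concatMap-UniqueMaxLast {n} (u , u<n , refl) with f-shape n
  ... | p , p≤n , eq =
    concatMap f u ++ p , ++⁺ (concatMap-bound u<n) (All-map s≤s p≤n) , image
    where
    open ≡-Reasoning
    image : concatMap f (u ∷ʳ n) ≡ (concatMap f u ++ p) ∷ʳ suc n
    image = begin
      concatMap f (u ∷ʳ n)                   ≡⟨ concatMap-++ f u (n ∷ []) ⟩
      concatMap f u ++ (f n ++ [])           ≡⟨ cong (concatMap f u ++_) (++-identityʳ (f n)) ⟩
      concatMap f u ++ f n                   ≡⟨ cong (concatMap f u ++_) eq ⟩
      concatMap f u ++ (p ∷ʳ suc n)          ≡⟨ ++-assoc (concatMap f u) p (suc n ∷ []) ⟨
      (concatMap f u ++ p) ∷ʳ suc n          ∎

module _ (k : ℕ) .{{_ : NonZero k}} where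

  k*[m/k]+m%k≡m : ∀ m → k * (m / k) + m % k ≡ m
  k*[m/k]+m%k≡m m = trans (cong (_+ m % k) (*-comm k (m / k)))
    (trans (+-comm (m / k * k) (m % k)) (sym (m≡m%n+[m/n]*n m k)))

  phiLetter-shape : ∀ m → ∃[ p ] All (_≤ m) p × phiLetter k m ≡ p ∷ʳ suc m
  phiLetter-shape m with suc (m % k) ≟ k
  ... | yes 1+m%k≡k = [] , [] , cong (_∷ []) (begin
    k * (m / k) + k            ≡⟨ cong (k * (m / k) +_) 1+m%k≡k ⟨
    k * (m / k) + suc (m % k)  ≡⟨ +-suc (k * (m / k)) (m % k) ⟩
    suc (k * (m / k) + m % k)  ≡⟨ cong suc (k*[m/k]+m%k≡m m) ⟩
    suc m                      ∎)
    where open ≡-Reasoning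
  ... | no _ = k * (m / k) ∷ [] , subst (k * (m / k) ≤_) (k*[m/k]+m%k≡m m) (m≤m+n _ _) ∷ [] ,
    cong (λ x → k * (m / k) ∷ x ∷ []) (trans (+-comm _ 1) (cong suc (k*[m/k]+m%k≡m m)))

  W-UniqueMaxLast : ∀ n → UniqueMaxLast n (W k n)
  W-UniqueMaxLast zero    = [] , [] , refl
  W-UniqueMaxLast (suc n) =
    LetterIncrementing.concatMap-UniqueMaxLast (phiLetter k) phiLetter-shape (W-UniqueMaxLast n)

lemma4p6 : (k : ℕ) → .{{_ : NonZero k}} → 3 ≤ k → (n : ℕ) → 1 ≤ n →
    All (λ x → x ≤ n) (W k n) × occurrences n (W k n) ≡ 1 × last (W k n) ≡ just n
lemma4p6 k _ n _ =
  UniqueMaxLast⇒All≤ invariant , UniqueMaxLast⇒occurrences≡1 invariant , UniqueMaxLast⇒last invariant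
  where
  invariant : UniqueMaxLast n (W k n)
  invariant = W-UniqueMaxLast k n
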